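{- Let $\sigma,\tau\in S_n$ be almost similar permutations of order $m$, and let $\mathrm{fix}(\pi)$ denote the number of fixed points of a permutation $\pi$. Then: (1) if $\mathrm{fix}(\sigma)=\mathrm{fix}(\tau)$, then $\sigma$ and $\tau$ are conjugate in $S_n$; (2) for every prime $p$ dividing $m$, $p$ divides $\mathrm{fix}(\sigma)-\mathrm{fix}(\tau)$.
   Context: Two elements $\sigma,\tau\in S_n$ are called almost similar if they have the same order $m$ and, for every divisor $k\neq 1$ of $m$, $\sigma^k$ and $\tau^k$ are conjugate in $S_n$. -}

module Defs where

open import Data.Nat using (ℕ; zero; suc; _<_)
open import Data.Nat.Divisibility using (_∣_)
open import Data.Fin using (Fin; _≟_)
open import Data.Fin.Permutation using (Permutation′; _⟨$⟩ʳ_; _∘ₚ_; flip; _≈_)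
import Data.Fin.Permutation as P
open import Data.List using (List; length; filter)
open import Data.List.Base using (allFin)
open import Data.Product using (Σ; ∃; _×_)
open import Relation.Nullary using (¬_)

-- π ^ k  (composition; _∘ₚ_ is diagrammatic, irrelevant for powers)
_^ₚ_ : ∀ {n} → Permutation′ n → ℕ → Permutation′ n
π ^ₚ zero  = P.id
π ^ₚ suc k = π ∘ₚ (π ^ₚ k)

HasOrder : ∀ {n} → Permutation′ n → ℕ → Set
HasOrder π m = (0 < m) × (π ^ₚ m ≈ P.id) × (∀ k → 0 < k → k < m → ¬ (π ^ₚ k ≈ P.id))

Conjugate : ∀ {n} → Permutation′ n → Permutation′ n → Set
Conjugate {n} σ τ = Σ (Permutation′ n) λ ρ → (flip ρ ∘ₚ σ ∘ₚ ρ) ≈ τ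

fix : ∀ {n} → Permutation′ n → ℕ
fix {n} π = length (filter (λ i → (π ⟨$⟩ʳ i) ≟ i) (allFin n))

AlmostSimilarOfOrder : ∀ {n} → Permutation′ n → Permutation′ n → ℕ → Set
AlmostSimilarOfOrder σ τ m =
  HasOrder σ m × HasOrder τ m ×
  (∀ k → k ∣ m → ¬ (k ≡ 1) → Conjugate (σ ^ₚ k) (τ ^ₚ k))
  where open import Relation.Binary.PropositionalEquality using (_≡_)

{-# OPTIONS --safe #-}
module Submission where

-- A permutation π with π ^ m = id has its cycle lengths determined by the numbers fix (π ^ k), k ∣ m:
-- the least k for which π ^ k fixes a point is the length of a shortest cycle, and a cycle of length d
-- contributes d to fix (π ^ k) if d ∣ k and 0 otherwise. Almost similarity gives fix (σ ^ k) = fix (τ ^ k)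
-- for the divisors k ≠ 1 of m, and fix σ = fix τ adds k = 1. So a shortest cycle of τ can be paired with
-- a cycle of σ of the same length; removing both keeps all counts equal, and the pairings assemble into
-- a conjugating bijection.
-- For a prime p, the points fixed by π ^ p but not by π fall into p-cycles, so fix (π ^ p) ≡ fix π
-- modulo p, and fix (σ ^ p) = fix (τ ^ p).

open import Defs
open import Data.Bool.Base using (Bool; true; false; _∧_; _∨_; not)
open import Data.Bool.Properties using (∧-identityʳ; ∧-zeroʳ; ∧-conicalˡ; ∧-conicalʳ; not-injective; ⇔→≡)
open import Data.Fin.Base using (Fin; zero; suc; toℕ; fromℕ<)
open import Data.Fin.Properties using (_≟_; any?; toℕ-injective; toℕ<n; toℕ-fromℕ<; suc-injective)
open import Data.Fin.Permutation
  using (Permutation′; _⟨$⟩ʳ_; _⟨$⟩ˡ_; flip; _≈_; inverseˡ; inverseʳ; permutation)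
import Data.Fin.Permutation as Perm
open import Data.List.Base using (length; filter; tabulate)
open import Data.Nat.Base
  using (ℕ; zero; suc; _+_; _*_; _∸_; _<_; _≤_; ∣_-_∣; NonZero; >-nonZero; >-nonZero⁻¹; z≤n; s≤s)
open import Data.Nat.Properties
  using (+-comm; +-cancelʳ-≡; ≤-trans; ≤-total; <-cmp; m≤n+m; m<m+n; m+[n∸m]≡n; n<1+n; n≢0⇒n>0;
         m<1+n⇒m<n∨m≡n; ∣m+n-m+o∣≡∣n-o∣; *-distribʳ-∣-∣; +-0-commutativeMonoid)
  renaming (_≟_ to _≟ℕ_; _<?_ to _<ℕ?_)
open import Data.Nat.DivMod using (_%_; _/_; m%n<n; m<n⇒m%n≡m; m≡m%n+[m/n]*n; %-remove-+ʳ)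
open import Data.Nat.Divisibility using (_∣_; divides; m%n≡0⇒n∣m; ∣m∣n⇒∣m+n; ∣-refl; _∣0; 1∣_)
open import Data.Nat.Induction using (<-wellFounded)
open import Data.Nat.Primality using (Prime; prime⇒nonZero; prime⇒irreducible; ¬prime[1])
open import Data.Product.Base using (∃; _×_; _,_; proj₁; proj₂)
open import Data.Sum.Base using (_⊎_; inj₁; inj₂; [_,_]′)
open import Function.Base using (_∘_; id)
open import Function.Bundles using (Injection; _⇔_; mk⇔)
open import Function.Definitions using (Injective)
open import Function.Properties.Inverse using (↔⇒↣)
open import Induction.WellFounded using (Acc; acc)
open import Relation.Binary.Definitions using (tri<; tri≈; tri>)
open import Relation.Binary.PropositionalEquality
  using (_≡_; _≢_; refl; sym; trans; cong; cong₂; subst; module ≡-Reasoning)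
open import Relation.Nullary.Decidable using (Dec; yes; no; does; dec-true; dec-false; does-⇔; _×-dec_)
open import Relation.Nullary.Negation using (¬_; contradiction)
open import Relation.Unary using (Decidable)
open import Algebra.Properties.CommutativeMonoid.Sum +-0-commutativeMonoid
  using (sum; sum-cong-≗; ∑-distrib-+; sum-permute; sum-replicate-zero)

open ≡-Reasoning

variable
  n : ℕ

does≡true⇒ : ∀ {a} {A : Set a} (a? : Dec A) → does a? ≡ true → A
does≡true⇒ (yes a) _ = a

∈-∉-elim : ∀ {a} {C : Set a} {b : Bool} → b ≡ true → b ≡ false → C
∈-∉-elim refl ()

∃-least : ∀ {p} {P : ℕ → Set p} → Decidable P → ∀ {b} → P b → ∃ λ d → P d × (∀ {j} → j < d → ¬ P j)
∃-least {P = P} P? {b} Pb with least-below (suc b)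
  where
  least-below : ∀ c → (∀ {j} → j < c → ¬ P j) ⊎ (∃ λ d → P d × (∀ {j} → j < d → ¬ P j))
  least-below zero = inj₁ λ ()
  least-below (suc c) with least-below c
  ... | inj₂ found = inj₂ found
  ... | inj₁ none with P? c
  ...   | yes Pc  = inj₂ (c , Pc , none)
  ...   | no  ¬Pc = inj₁ λ j<1+c → [ none , (λ { refl → ¬Pc }) ]′ (m<1+n⇒m<n∨m≡n j<1+c)
... | inj₁ none  = contradiction Pb (none (n<1+n b))
... | inj₂ found = found

indicator : Bool → ℕ
indicator true  = 1
indicator false = 0

count : (Fin n → Bool) → ℕ
count P = sum (indicator ∘ P)

infixr 7 _∩_
infixl 6 _∖_
infix  4 _⊆_

_∩_ _∖_ : (P Q : Fin n → Bool) → Fin n → Bool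
(P ∩ Q) z = P z ∧ Q z
(P ∖ Q) z = P z ∧ not (Q z)

_⊆_ : (P Q : Fin n → Bool) → Set
P ⊆ Q = ∀ {z} → P z ≡ true → Q z ≡ true

∖-intro : ∀ {P Q : Fin n → Bool} {z} → P z ≡ true → Q z ≡ false → (P ∖ Q) z ≡ true
∖-intro z∈P z∉Q = cong₂ (λ p q → p ∧ not q) z∈P z∉Q

∖-elim : ∀ {P Q : Fin n → Bool} {z} → (P ∖ Q) z ≡ true → P z ≡ true × Q z ≡ false
∖-elim e = ∧-conicalˡ _ _ e , not-injective (∧-conicalʳ _ _ e)

count-cong : ∀ {P Q : Fin n → Bool} → (∀ z → P z ≡ Q z) → count P ≡ count Q
count-cong P≗Q = sum-cong-≗ (cong indicator ∘ P≗Q)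

count-none : ∀ {P : Fin n → Bool} → (∀ z → P z ≡ false) → count P ≡ 0
count-none {n} P≗∅ = trans (count-cong P≗∅) (sum-replicate-zero n)

count-permute : ∀ {P : Fin n → Bool} (ρ : Permutation′ n) → count (P ∘ (ρ ⟨$⟩ʳ_)) ≡ count P
count-permute {P = P} ρ = sym (sum-permute (indicator ∘ P) ρ)

∈⇒0<count : ∀ {P : Fin n → Bool} z → P z ≡ true → 0 < count P
∈⇒0<count zero    z∈P rewrite z∈P = s≤s z≤n
∈⇒0<count {P = P} (suc z) z∈P = ≤-trans (∈⇒0<count z z∈P) (m≤n+m _ (indicator (P zero)))

0<count⇒∈ : ∀ {P : Fin n → Bool} → 0 < count P → ∃ λ z → P z ≡ true
0<count⇒∈ {suc n} {P} 0<count with P zero in z∈P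
... | true  = zero , z∈P
... | false with z , z∈P ← 0<count⇒∈ {P = P ∘ suc} 0<count = suc z , z∈P

count≡0⇒∉ : ∀ {P : Fin n → Bool} → count P ≡ 0 → ∀ z → P z ≡ false
count≡0⇒∉ {P = P} count≡0 z with P z in z∈P
... | true  = contradiction (subst (0 <_) count≡0 (∈⇒0<count z z∈P)) λ ()
... | false = refl

indicator-∨ : ∀ p q → (p ≡ true → q ≡ false) → indicator (p ∨ q) ≡ indicator p + indicator q
indicator-∨ false q    _        = refl
indicator-∨ true  false _       = refl
indicator-∨ true  true disjoint = contradiction (disjoint refl) λ ()

count-∨ : ∀ {P Q : Fin n → Bool} → (∀ {z} → P z ≡ true → Q z ≡ false) →
          count (λ z → P z ∨ Q z) ≡ count P + count Q
count-∨ {P = P} {Q} disjoint =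
  trans (sum-cong-≗ λ z → indicator-∨ (P z) (Q z) disjoint) (∑-distrib-+ (indicator ∘ P) (indicator ∘ Q))

indicator-∖ : ∀ p o → (o ≡ true → p ≡ true) → indicator p ≡ indicator (p ∧ not o) + indicator o
indicator-∖ false false _   = refl
indicator-∖ false true  o⇒p = contradiction (o⇒p refl) λ ()
indicator-∖ true  false _   = refl
indicator-∖ true  true  _   = refl

count-∖ : ∀ {P O : Fin n → Bool} → O ⊆ P → count P ≡ count (P ∖ O) + count O
count-∖ {P = P} {O} O⊆P =
  trans (sum-cong-≗ λ z → indicator-∖ (P z) (O z) O⊆P) (∑-distrib-+ (indicator ∘ (P ∖ O)) (indicator ∘ O))

indicator-∖-∩ : ∀ p o f → (o ≡ true → p ≡ true) →
                indicator (p ∧ f) ≡ indicator ((p ∧ not o) ∧ f) + indicator (o ∧ f)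
indicator-∖-∩ p o false _ rewrite ∧-zeroʳ p | ∧-zeroʳ (p ∧ not o) | ∧-zeroʳ o = refl
indicator-∖-∩ p o true o⇒p rewrite ∧-identityʳ p | ∧-identityʳ (p ∧ not o) | ∧-identityʳ o = indicator-∖ p o o⇒p

count-∖-∩ : ∀ {P O : Fin n → Bool} → O ⊆ P → ∀ F → count (P ∩ F) ≡ count ((P ∖ O) ∩ F) + count (O ∩ F)
count-∖-∩ {P = P} {O} O⊆P F =
  trans (sum-cong-≗ λ z → indicator-∖-∩ (P z) (O z) (F z) O⊆P)
        (∑-distrib-+ (indicator ∘ ((P ∖ O) ∩ F)) (indicator ∘ (O ∩ F)))

count-∧-const : ∀ {P Q : Fin n → Bool} → count P ≡ count Q →
                ∀ b → count (λ z → P z ∧ b) ≡ count (λ z → Q z ∧ b)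
count-∧-const {P = P} {Q} |P|≡|Q| true  =
  trans (count-cong (∧-identityʳ ∘ P)) (trans |P|≡|Q| (sym (count-cong (∧-identityʳ ∘ Q))))
count-∧-const {P = P} {Q} _       false =
  trans (count-none (∧-zeroʳ ∘ P)) (sym (count-none (∧-zeroʳ ∘ Q)))

image : ∀ {d} → (Fin d → Fin n) → Fin n → Bool
image h z = does (any? λ j → h j ≟ z)

image-intro : ∀ {d} (h : Fin d → Fin n) {z} j → h j ≡ z → image h z ≡ true
image-intro h j hj≡z = dec-true (any? _) (j , hj≡z)

image-elim : ∀ {d} (h : Fin d → Fin n) {z} → image h z ≡ true → ∃ λ j → h j ≡ z
image-elim h {z} = does≡true⇒ (any? λ j → h j ≟ z)

count-singleton : (a : Fin n) → count (λ z → does (a ≟ z)) ≡ 1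
count-singleton {suc n} zero    = cong suc (count-none {n} λ _ → refl)
count-singleton {suc n} (suc a) = count-singleton a

count-image : ∀ {d} (h : Fin d → Fin n) → Injective _≡_ _≡_ h → count (image h) ≡ d
count-image {d = zero}  h _     = count-none {P = image h} λ _ → refl
count-image {d = suc d} h h-inj = begin
  count (image h)
    ≡⟨ count-∨ {P = λ z → does (h zero ≟ z)} {Q = image (h ∘ suc)} disjoint ⟩
  count (λ z → does (h zero ≟ z)) + count (image (h ∘ suc))
    ≡⟨ cong₂ _+_ (count-singleton (h zero)) (count-image (h ∘ suc) (suc-injective ∘ h-inj)) ⟩
  suc d ∎
  where
  disjoint : ∀ {z} → does (h zero ≟ z) ≡ true → image (h ∘ suc) z ≡ false
  disjoint {z} h0≡z = dec-false (any? λ j → h (suc j) ≟ z) λ (j , hj≡z) →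
    contradiction (h-inj (trans (does≡true⇒ (h zero ≟ z) h0≡z) (sym hj≡z))) λ ()

infix 8 _^_⟨$⟩_

_^_⟨$⟩_ : Permutation′ n → ℕ → Fin n → Fin n
π ^ k ⟨$⟩ x = (π ^ₚ k) ⟨$⟩ʳ x

module _ (π : Permutation′ n) where

  pow-+ : ∀ a b x → π ^ (a + b) ⟨$⟩ x ≡ π ^ b ⟨$⟩ (π ^ a ⟨$⟩ x)
  pow-+ zero    b x = refl
  pow-+ (suc a) b x = pow-+ a b (π ⟨$⟩ʳ x)

  pow-suc : ∀ k x → π ^ suc k ⟨$⟩ x ≡ π ⟨$⟩ʳ (π ^ k ⟨$⟩ x)
  pow-suc k x = trans (cong (λ t → π ^ t ⟨$⟩ x) (+-comm 1 k)) (pow-+ k 1 x)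

  pow-comm : ∀ a b x → π ^ a ⟨$⟩ (π ^ b ⟨$⟩ x) ≡ π ^ b ⟨$⟩ (π ^ a ⟨$⟩ x)
  pow-comm a b x = begin
    π ^ a ⟨$⟩ (π ^ b ⟨$⟩ x) ≡⟨ pow-+ b a x ⟨
    π ^ (b + a) ⟨$⟩ x       ≡⟨ cong (λ t → π ^ t ⟨$⟩ x) (+-comm b a) ⟩
    π ^ (a + b) ⟨$⟩ x       ≡⟨ pow-+ a b x ⟩
    π ^ b ⟨$⟩ (π ^ a ⟨$⟩ x) ∎

  pow-injective : ∀ k {x y} → π ^ k ⟨$⟩ x ≡ π ^ k ⟨$⟩ y → x ≡ y
  pow-injective zero    e = e
  pow-injective (suc k) e = Injection.injective (↔⇒↣ π) (pow-injective k e)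

  pow-*-fixed : ∀ q {d x} → π ^ d ⟨$⟩ x ≡ x → π ^ (q * d) ⟨$⟩ x ≡ x
  pow-*-fixed zero    e = refl
  pow-*-fixed (suc q) {d} {x} e = begin
    π ^ (d + q * d) ⟨$⟩ x         ≡⟨ pow-+ d (q * d) x ⟩
    π ^ (q * d) ⟨$⟩ (π ^ d ⟨$⟩ x) ≡⟨ cong (λ y → π ^ (q * d) ⟨$⟩ y) e ⟩
    π ^ (q * d) ⟨$⟩ x             ≡⟨ pow-*-fixed q e ⟩
    x                             ∎

  pow-fixed-∣ : ∀ {d k x} → π ^ d ⟨$⟩ x ≡ x → d ∣ k → π ^ k ⟨$⟩ x ≡ x
  pow-fixed-∣ e (divides q refl) = pow-*-fixed q e

Fix : Permutation′ n → ℕ → Fin n → Bool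
Fix π k z = does (π ^ k ⟨$⟩ z ≟ z)

Fix-intro : ∀ (π : Permutation′ n) k {z} → π ^ k ⟨$⟩ z ≡ z → Fix π k z ≡ true
Fix-intro π k = dec-true (_ ≟ _)

Fix-elim : ∀ (π : Permutation′ n) k {z} → Fix π k z ≡ true → π ^ k ⟨$⟩ z ≡ z
Fix-elim π k = does≡true⇒ (_ ≟ _)

Fix-≡ : ∀ (π ρ : Permutation′ n) k l {z w} → (π ^ k ⟨$⟩ z ≡ z ⇔ ρ ^ l ⟨$⟩ w ≡ w) → Fix π k z ≡ Fix ρ l w
Fix-≡ π ρ k l equiv = does-⇔ equiv (_ ≟ _) (_ ≟ _)

∩-Fix-intro : ∀ (P : Fin n → Bool) π k {z} → P z ≡ true → π ^ k ⟨$⟩ z ≡ z → (P ∩ Fix π k) z ≡ true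
∩-Fix-intro P π k z∈P fixed = cong₂ _∧_ z∈P (Fix-intro π k fixed)

∩-Fix-elim : ∀ (P : Fin n → Bool) π k {z} → (P ∩ Fix π k) z ≡ true → P z ≡ true × π ^ k ⟨$⟩ z ≡ z
∩-Fix-elim P π k e = ∧-conicalˡ _ _ e , Fix-elim π k (∧-conicalʳ _ _ e)

count-∩-Fix-id : ∀ (P : Fin n → Bool) π k → π ^ₚ k ≈ Perm.id → count (P ∩ Fix π k) ≡ count P
count-∩-Fix-id P π k π^k≈id = count-cong λ z → trans (cong (P z ∧_) (Fix-intro π k (π^k≈id z))) (∧-identityʳ (P z))

length-filter-tabulate : ∀ {A : Set} {P : A → Set} (P? : Decidable P) (f : Fin n → A) →
                         length (filter P? (tabulate f)) ≡ count (λ i → does (P? (f i)))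
length-filter-tabulate {zero}  P? f = refl
length-filter-tabulate {suc n} P? f with does (P? (f zero))
... | true  = cong suc (length-filter-tabulate P? (f ∘ suc))
... | false = length-filter-tabulate P? (f ∘ suc)

fix-pow≡count-Fix : ∀ (π : Permutation′ n) k → fix (π ^ₚ k) ≡ count (Fix π k)
fix-pow≡count-Fix π k = length-filter-tabulate (λ i → π ^ k ⟨$⟩ i ≟ i) id

conjugate⇒fix≡ : ∀ {σ τ : Permutation′ n} → Conjugate σ τ → fix σ ≡ fix τ
conjugate⇒fix≡ {σ = σ} {τ} (ρ , ρ⁻¹σρ≈τ) = begin
  fix σ                       ≡⟨ fix-pow≡count-Fix σ 1 ⟩
  count (Fix σ 1)             ≡⟨ count-permute (flip ρ) ⟨
  count (Fix σ 1 ∘ (ρ ⟨$⟩ˡ_)) ≡⟨ count-cong (λ i → Fix-≡ σ τ 1 1 (mk⇔ (fixed⇒ i) (⇒fixed i))) ⟩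
  count (Fix τ 1)             ≡⟨ fix-pow≡count-Fix τ 1 ⟨
  fix τ                       ∎
  where
  fixed⇒ : ∀ i → σ ⟨$⟩ʳ (ρ ⟨$⟩ˡ i) ≡ ρ ⟨$⟩ˡ i → τ ⟨$⟩ʳ i ≡ i
  fixed⇒ i e = trans (sym (ρ⁻¹σρ≈τ i)) (trans (cong (ρ ⟨$⟩ʳ_) e) (inverseʳ ρ))
  ⇒fixed : ∀ i → τ ⟨$⟩ʳ i ≡ i → σ ⟨$⟩ʳ (ρ ⟨$⟩ˡ i) ≡ ρ ⟨$⟩ˡ i
  ⇒fixed i e = trans (sym (inverseˡ ρ)) (cong (ρ ⟨$⟩ˡ_) (trans (ρ⁻¹σρ≈τ i) e))

Invariant : Permutation′ n → (Fin n → Bool) → Set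
Invariant π S = ∀ z → S (π ⟨$⟩ʳ z) ≡ S z

∖-invariant : ∀ {π : Permutation′ n} {P Q} → Invariant π P → Invariant π Q → Invariant π (P ∖ Q)
∖-invariant P-inv Q-inv z = cong₂ (λ p q → p ∧ not q) (P-inv z) (Q-inv z)

invariant-pow : ∀ {π : Permutation′ n} {S} → Invariant π S → ∀ k z → S (π ^ k ⟨$⟩ z) ≡ S z
invariant-pow S-inv zero    z = refl
invariant-pow S-inv (suc k) z = trans (invariant-pow S-inv k _) (S-inv z)

Fix-invariant : ∀ (π : Permutation′ n) k → Invariant π (Fix π k)
Fix-invariant π k z = Fix-≡ π π k k (mk⇔ (λ e → pow-injective π 1 (trans (sym (pow-suc π k z)) e))
                                  (λ e → trans (pow-suc π k z) (cong (π ⟨$⟩ʳ_) e)))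

-- The first d iterates of x: the orbit of x when d is its period.
orbit : Permutation′ n → Fin n → ℕ → Fin n → Bool
orbit π x d = image (λ (j : Fin d) → π ^ toℕ j ⟨$⟩ x)

orbit-elim : ∀ {π : Permutation′ n} {x d z} → orbit π x d z ≡ true → ∃ λ (j : Fin d) → π ^ toℕ j ⟨$⟩ x ≡ z
orbit-elim {π = π} {x} = image-elim (λ j → π ^ toℕ j ⟨$⟩ x)

orbit-⊆ : ∀ {π : Permutation′ n} {S x d} → Invariant π S → S x ≡ true → orbit π x d ⊆ S
orbit-⊆ {π = π} {S} {x} {d} S-inv x∈S z∈O with j , refl ← orbit-elim {π = π} {x} {d} z∈O =
  trans (invariant-pow S-inv (toℕ j) x) x∈S

Fix-along-orbit : ∀ {π : Permutation′ n} {x d z} k → orbit π x d z ≡ true → Fix π k z ≡ Fix π k x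
Fix-along-orbit {π = π} {x} {d} k z∈O with j , refl ← orbit-elim {π = π} {x} {d} z∈O =
  Fix-≡ π π k k (mk⇔ (λ e → pow-injective π (toℕ j) (trans (pow-comm π (toℕ j) k x) e))
                     (λ e → trans (pow-comm π k (toℕ j) x) (cong (λ y → π ^ toℕ j ⟨$⟩ y) e)))

orbit-∩-Fix : ∀ (π : Permutation′ n) x d k z → orbit π x d z ∧ Fix π k z ≡ orbit π x d z ∧ Fix π k x
orbit-∩-Fix π x d k z with orbit π x d z in z∈O
... | true  = Fix-along-orbit {π = π} {x} {d} k z∈O
... | false = refl

record Period (π : Permutation′ n) (x : Fin n) (d : ℕ) : Set where
  field
    positive : 0 < d
    returns  : π ^ d ⟨$⟩ x ≡ x
    minimal  : ∀ {j} → 0 < j → j < d → π ^ j ⟨$⟩ x ≢ x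

period-exists : ∀ {π : Permutation′ n} {x k} → 0 < k → π ^ k ⟨$⟩ x ≡ x → ∃ (Period π x)
period-exists {π = π} {x} 0<k e
  with d , (0<d , returns) , below ← ∃-least (λ j → 0 <ℕ? j ×-dec π ^ j ⟨$⟩ x ≟ x) (0<k , e) =
  d , record { positive = 0<d ; returns = returns ; minimal = λ 0<j j<d e → below j<d (0<j , e) }

module _ {π : Permutation′ n} {x : Fin n} {d : ℕ} (P : Period π x d) where
  open Period P

  private instance
    d≢0 : NonZero d
    d≢0 = >-nonZero positive

  pow-mod : ∀ j → π ^ j ⟨$⟩ x ≡ π ^ (j % d) ⟨$⟩ x
  pow-mod j = begin
    π ^ j ⟨$⟩ x                               ≡⟨ cong (λ t → π ^ t ⟨$⟩ x) (m≡m%n+[m/n]*n j d) ⟩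
    π ^ (j % d + j / d * d) ⟨$⟩ x             ≡⟨ pow-+ π (j % d) (j / d * d) x ⟩
    π ^ (j / d * d) ⟨$⟩ (π ^ (j % d) ⟨$⟩ x)   ≡⟨ pow-comm π (j / d * d) (j % d) x ⟩
    π ^ (j % d) ⟨$⟩ (π ^ (j / d * d) ⟨$⟩ x)   ≡⟨ cong (λ y → π ^ (j % d) ⟨$⟩ y) (pow-*-fixed π (j / d) returns) ⟩
    π ^ (j % d) ⟨$⟩ x                         ∎

  fixed-below-period⇒0 : ∀ {j} → j < d → π ^ j ⟨$⟩ x ≡ x → j ≡ 0
  fixed-below-period⇒0 {zero}  _   _ = refl
  fixed-below-period⇒0 {suc j} j<d e = contradiction e (minimal (s≤s z≤n) j<d)

  period-∣ : ∀ {k} → π ^ k ⟨$⟩ x ≡ x → d ∣ k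
  period-∣ {k} e = m%n≡0⇒n∣m k d (fixed-below-period⇒0 (m%n<n k d) (trans (sym (pow-mod k)) e))

  pow-≡⇒%-≡-≤ : ∀ {i j} → i ≤ j → π ^ i ⟨$⟩ x ≡ π ^ j ⟨$⟩ x → i % d ≡ j % d
  pow-≡⇒%-≡-≤ {i} {j} i≤j e = begin
    i % d             ≡⟨ %-remove-+ʳ i (period-∣ gap-fixed) ⟨
    (i + (j ∸ i)) % d ≡⟨ cong (λ t → t % d) (m+[n∸m]≡n i≤j) ⟩
    j % d             ∎
    where
    gap-fixed : π ^ (j ∸ i) ⟨$⟩ x ≡ x
    gap-fixed = sym (pow-injective π i (begin
      π ^ i ⟨$⟩ x                   ≡⟨ e ⟩
      π ^ j ⟨$⟩ x                   ≡⟨ cong (λ t → π ^ t ⟨$⟩ x) (m+[n∸m]≡n i≤j) ⟨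
      π ^ (i + (j ∸ i)) ⟨$⟩ x       ≡⟨ pow-+ π i (j ∸ i) x ⟩
      π ^ (j ∸ i) ⟨$⟩ (π ^ i ⟨$⟩ x) ≡⟨ pow-comm π (j ∸ i) i x ⟩
      π ^ i ⟨$⟩ (π ^ (j ∸ i) ⟨$⟩ x) ∎))

  pow-≡⇒%-≡ : ∀ {i j} → π ^ i ⟨$⟩ x ≡ π ^ j ⟨$⟩ x → i % d ≡ j % d
  pow-≡⇒%-≡ {i} {j} e with ≤-total i j
  ... | inj₁ i≤j = pow-≡⇒%-≡-≤ i≤j e
  ... | inj₂ j≤i = sym (pow-≡⇒%-≡-≤ j≤i (sym e))

  orbit-witness : ∀ k → ∃ λ (j : Fin d) → π ^ toℕ j ⟨$⟩ x ≡ π ^ k ⟨$⟩ x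
  orbit-witness k = fromℕ< (m%n<n k d) , trans (cong (λ t → π ^ t ⟨$⟩ x) (toℕ-fromℕ< (m%n<n k d))) (sym (pow-mod k))

  orbit-intro : ∀ k → orbit π x d (π ^ k ⟨$⟩ x) ≡ true
  orbit-intro k = image-intro (λ (j : Fin d) → π ^ toℕ j ⟨$⟩ x) (proj₁ (orbit-witness k)) (proj₂ (orbit-witness k))

  count-orbit : count (orbit π x d) ≡ d
  count-orbit = count-image (λ (j : Fin d) → π ^ toℕ j ⟨$⟩ x) λ {i} {j} e → toℕ-injective (begin
    toℕ i     ≡⟨ m<n⇒m%n≡m (toℕ<n i) ⟨
    toℕ i % d ≡⟨ pow-≡⇒%-≡ e ⟩
    toℕ j % d ≡⟨ m<n⇒m%n≡m (toℕ<n j) ⟩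
    toℕ j     ∎)

orbit-invariant : ∀ {π : Permutation′ n} {x d} → Period π x d → Invariant π (orbit π x d)
orbit-invariant {d = zero} P = contradiction (Period.positive P) λ ()
orbit-invariant {π = π} {x} {suc e} P z = ⇔→≡ (mk⇔ from-πz to-πz)
  where
  O = orbit π x (suc e)
  to-πz : O z ≡ true → O (π ⟨$⟩ʳ z) ≡ true
  to-πz z∈O with j , πʲx≡z ← orbit-elim {π = π} {x} {suc e} {z} z∈O =
    subst (λ w → O w ≡ true) (trans (pow-suc π (toℕ j) x) (cong (π ⟨$⟩ʳ_) πʲx≡z)) (orbit-intro P (suc (toℕ j)))
  from-πz : O (π ⟨$⟩ʳ z) ≡ true → O z ≡ true
  from-πz πz∈O with j , πʲx≡πz ← orbit-elim {π = π} {x} {suc e} {π ⟨$⟩ʳ z} πz∈O =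
    subst (λ w → O w ≡ true) (pow-injective π 1 (begin
      π ⟨$⟩ʳ (π ^ (e + toℕ j) ⟨$⟩ x) ≡⟨ pow-suc π (e + toℕ j) x ⟨
      π ^ (suc e + toℕ j) ⟨$⟩ x      ≡⟨ pow-+ π (suc e) (toℕ j) x ⟩
      π ^ toℕ j ⟨$⟩ (π ^ suc e ⟨$⟩ x) ≡⟨ cong (λ y → π ^ toℕ j ⟨$⟩ y) (Period.returns P) ⟩
      π ^ toℕ j ⟨$⟩ x                ≡⟨ πʲx≡πz ⟩
      π ⟨$⟩ʳ z                       ∎)) (orbit-intro P (e + toℕ j))

count-∖-orbit : ∀ {π : Permutation′ n} {S x d} → Invariant π S → S x ≡ true → Period π x d →
                count S ≡ count (S ∖ orbit π x d) + d
count-∖-orbit {π = π} {S} {x} {d} S-inv x∈S P =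
  trans (count-∖ {P = S} (orbit-⊆ {π = π} {S} {x} {d} S-inv x∈S)) (cong (count (S ∖ orbit π x d) +_) (count-orbit P))

period-transfer : ∀ {π₁ π₂ : Permutation′ n} {a b d} i j → Period π₁ a d → Period π₂ b d →
                  π₁ ^ i ⟨$⟩ a ≡ π₁ ^ j ⟨$⟩ a → π₂ ^ i ⟨$⟩ b ≡ π₂ ^ j ⟨$⟩ b
period-transfer {π₂ = π₂} {b = b} i j P₁ P₂ e =
  trans (pow-mod P₂ i) (trans (cong (λ t → π₂ ^ t ⟨$⟩ b) (pow-≡⇒%-≡ P₁ {i} {j} e)) (sym (pow-mod P₂ j)))

count-orbit-∩-Fix : ∀ {π₁ π₂ : Permutation′ n} {a b d} → Period π₁ a d → Period π₂ b d → ∀ k →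
                    count (orbit π₁ a d ∩ Fix π₁ k) ≡ count (orbit π₂ b d ∩ Fix π₂ k)
count-orbit-∩-Fix {π₁ = π₁} {π₂} {a} {b} {d} P₁ P₂ k = begin
  count (orbit π₁ a d ∩ Fix π₁ k)           ≡⟨ count-cong (orbit-∩-Fix π₁ a d k) ⟩
  count (λ z → orbit π₁ a d z ∧ Fix π₁ k a) ≡⟨ cong (λ c → count (λ z → orbit π₁ a d z ∧ c)) Fix-a≡Fix-b ⟩
  count (λ z → orbit π₁ a d z ∧ Fix π₂ k b) ≡⟨ count-∧-const {P = orbit π₁ a d} {orbit π₂ b d} |O₁|≡|O₂| _ ⟩
  count (λ z → orbit π₂ b d z ∧ Fix π₂ k b) ≡⟨ count-cong (orbit-∩-Fix π₂ b d k) ⟨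
  count (orbit π₂ b d ∩ Fix π₂ k)           ∎
  where
  Fix-a≡Fix-b : Fix π₁ k a ≡ Fix π₂ k b
  Fix-a≡Fix-b = Fix-≡ π₁ π₂ k k (mk⇔ (period-transfer k 0 P₁ P₂) (period-transfer k 0 P₂ P₁))
  |O₁|≡|O₂| : count (orbit π₁ a d) ≡ count (orbit π₂ b d)
  |O₁|≡|O₂| = trans (count-orbit P₁) (sym (count-orbit P₂))

extend : (π₁ : Permutation′ n) (a : Fin n) (π₂ : Permutation′ n) (b : Fin n) (d : ℕ) →
         (Fin n → Fin n) → Fin n → Fin n
extend π₁ a π₂ b d f z with any? (λ (j : Fin d) → π₁ ^ toℕ j ⟨$⟩ a ≟ z)
... | yes (j , _) = π₂ ^ toℕ j ⟨$⟩ b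
... | no  _       = f z

extend-off-orbit : ∀ (π₁ : Permutation′ n) a π₂ b d f {z} → orbit π₁ a d z ≡ false → extend π₁ a π₂ b d f z ≡ f z
extend-off-orbit π₁ a π₂ b d f {z} z∉O with any? (λ (j : Fin d) → π₁ ^ toℕ j ⟨$⟩ a ≟ z)
... | yes _ = contradiction z∉O λ ()
... | no  _ = refl

extend-on-orbit : ∀ {π₁ π₂ : Permutation′ n} {a b d} → Period π₁ a d → Period π₂ b d → ∀ f k →
                  extend π₁ a π₂ b d f (π₁ ^ k ⟨$⟩ a) ≡ π₂ ^ k ⟨$⟩ b
extend-on-orbit {π₁ = π₁} {π₂} {a} {b} {d} P₁ P₂ f k with any? (λ (j : Fin d) → π₁ ^ toℕ j ⟨$⟩ a ≟ π₁ ^ k ⟨$⟩ a)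
... | yes (j , e) = period-transfer (toℕ j) k P₁ P₂ e
... | no  ∄j      = contradiction (orbit-witness P₁ k) ∄j

module _ {π₁ π₂ : Permutation′ n} {a b d} (P₁ : Period π₁ a d) (P₂ : Period π₂ b d) {A B : Fin n → Bool} where

  private
    O₁ = orbit π₁ a d
    O₂ = orbit π₂ b d

  extend-∈ : Invariant π₂ B → B b ≡ true → ∀ {f} → (∀ {z} → (A ∖ O₁) z ≡ true → (B ∖ O₂) (f z) ≡ true) →
             ∀ {z} → A z ≡ true → B (extend π₁ a π₂ b d f z) ≡ true
  extend-∈ B-inv b∈B {f} f-∈ {z} z∈A with O₁ z in z∈O
  ... | true with j , refl ← orbit-elim {π = π₁} {a} {d} {z} z∈O =
    trans (cong B (extend-on-orbit P₁ P₂ f (toℕ j))) (trans (invariant-pow B-inv (toℕ j) b) b∈B)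
  ... | false = trans (cong B (extend-off-orbit π₁ a π₂ b d f z∈O))
                      (proj₁ (∖-elim {P = B} {O₂} (f-∈ (∖-intro {P = A} {O₁} z∈A z∈O))))

  extend-cancel : ∀ {f g} → (∀ {z} → (A ∖ O₁) z ≡ true → (B ∖ O₂) (f z) ≡ true) →
                  (∀ {z} → (A ∖ O₁) z ≡ true → g (f z) ≡ z) →
                  ∀ {z} → A z ≡ true → extend π₂ b π₁ a d g (extend π₁ a π₂ b d f z) ≡ z
  extend-cancel {f} {g} f-∈ g∘f {z} z∈A with O₁ z in z∈O
  ... | true with j , refl ← orbit-elim {π = π₁} {a} {d} {z} z∈O =
    trans (cong (extend π₂ b π₁ a d g) (extend-on-orbit P₁ P₂ f (toℕ j))) (extend-on-orbit P₂ P₁ g (toℕ j))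
  ... | false = begin
    extend π₂ b π₁ a d g (extend π₁ a π₂ b d f z)
      ≡⟨ cong (extend π₂ b π₁ a d g) (extend-off-orbit π₁ a π₂ b d f z∈O) ⟩
    extend π₂ b π₁ a d g (f z)
      ≡⟨ extend-off-orbit π₂ b π₁ a d g (proj₂ (∖-elim {P = B} {O₂} (f-∈ z∈A∖O₁))) ⟩
    g (f z)
      ≡⟨ g∘f z∈A∖O₁ ⟩
    z ∎
    where
    z∈A∖O₁ : (A ∖ O₁) z ≡ true
    z∈A∖O₁ = ∖-intro {P = A} {O₁} z∈A z∈O

  extend-intertwines : ∀ {f} → (∀ {z} → (A ∖ O₁) z ≡ true → π₂ ⟨$⟩ʳ f z ≡ f (π₁ ⟨$⟩ʳ z)) →
                       ∀ {z} → A z ≡ true → π₂ ⟨$⟩ʳ extend π₁ a π₂ b d f z ≡ extend π₁ a π₂ b d f (π₁ ⟨$⟩ʳ z)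
  extend-intertwines {f} f-intertwines {z} z∈A with O₁ z in z∈O
  ... | true with j , refl ← orbit-elim {π = π₁} {a} {d} {z} z∈O = begin
    π₂ ⟨$⟩ʳ g (π₁ ^ toℕ j ⟨$⟩ a)  ≡⟨ cong (π₂ ⟨$⟩ʳ_) (extend-on-orbit P₁ P₂ f (toℕ j)) ⟩
    π₂ ⟨$⟩ʳ (π₂ ^ toℕ j ⟨$⟩ b)    ≡⟨ pow-suc π₂ (toℕ j) b ⟨
    π₂ ^ suc (toℕ j) ⟨$⟩ b        ≡⟨ extend-on-orbit P₁ P₂ f (suc (toℕ j)) ⟨
    g (π₁ ^ suc (toℕ j) ⟨$⟩ a)    ≡⟨ cong g (pow-suc π₁ (toℕ j) a) ⟩
    g (π₁ ⟨$⟩ʳ (π₁ ^ toℕ j ⟨$⟩ a)) ∎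
    where
    g = extend π₁ a π₂ b d f
  ... | false = begin
    π₂ ⟨$⟩ʳ extend π₁ a π₂ b d f z   ≡⟨ cong (π₂ ⟨$⟩ʳ_) (extend-off-orbit π₁ a π₂ b d f z∈O) ⟩
    π₂ ⟨$⟩ʳ f z                      ≡⟨ f-intertwines (∖-intro {P = A} {O₁} z∈A z∈O) ⟩
    f (π₁ ⟨$⟩ʳ z)                    ≡⟨ extend-off-orbit π₁ a π₂ b d f (trans (orbit-invariant P₁ z) z∈O) ⟨
    extend π₁ a π₂ b d f (π₁ ⟨$⟩ʳ z) ∎

-- A bijection from A onto B carrying π₁ to π₂, given by total functions constrained only on A and B.
record Matching (π₁ π₂ : Permutation′ n) (A B : Fin n → Bool) : Set where
  field
    to from        : Fin n → Fin n
    to-∈           : ∀ {z} → A z ≡ true → B (to z) ≡ true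
    from-∈         : ∀ {w} → B w ≡ true → A (from w) ≡ true
    from-to        : ∀ {z} → A z ≡ true → from (to z) ≡ z
    to-from        : ∀ {w} → B w ≡ true → to (from w) ≡ w
    to-intertwines : ∀ {z} → A z ≡ true → π₂ ⟨$⟩ʳ to z ≡ to (π₁ ⟨$⟩ʳ z)

empty-matching : ∀ {π₁ π₂ : Permutation′ n} {A B} → (∀ z → A z ≡ false) → (∀ w → B w ≡ false) →
                 Matching π₁ π₂ A B
empty-matching A≡∅ B≡∅ = record
  { to             = id
  ; from           = id
  ; to-∈           = λ {z} z∈A → ∈-∉-elim z∈A (A≡∅ z)
  ; from-∈         = λ {w} w∈B → ∈-∉-elim w∈B (B≡∅ w)
  ; from-to        = λ {z} z∈A → ∈-∉-elim z∈A (A≡∅ z)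
  ; to-from        = λ {w} w∈B → ∈-∉-elim w∈B (B≡∅ w)
  ; to-intertwines = λ {z} z∈A → ∈-∉-elim z∈A (A≡∅ z)
  }

extend-matching : ∀ {π₁ π₂ : Permutation′ n} {a b d A B} → Period π₁ a d → Period π₂ b d →
                  Invariant π₁ A → Invariant π₂ B → A a ≡ true → B b ≡ true →
                  Matching π₁ π₂ (A ∖ orbit π₁ a d) (B ∖ orbit π₂ b d) → Matching π₁ π₂ A B
extend-matching {π₁ = π₁} {π₂} {a} {b} {d} {A} {B} P₁ P₂ A-inv B-inv a∈A b∈B M = record
  { to             = extend π₁ a π₂ b d to
  ; from           = extend π₂ b π₁ a d from
  ; to-∈           = extend-∈ P₁ P₂ {A} {B} B-inv b∈B to-∈
  ; from-∈         = extend-∈ P₂ P₁ {B} {A} A-inv a∈A from-∈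
  ; from-to        = extend-cancel P₁ P₂ {A} {B} to-∈ from-to
  ; to-from        = extend-cancel P₂ P₁ {B} {A} from-∈ to-from
  ; to-intertwines = extend-intertwines P₁ P₂ {A} {B} to-intertwines
  }
  where open Matching M

matching⇒conjugate : ∀ {π₁ π₂ : Permutation′ n} → Matching π₁ π₂ (λ _ → true) (λ _ → true) → Conjugate π₂ π₁
matching⇒conjugate M =
  permutation from to (λ _ → from-to refl) (λ _ → to-from refl) ,
  λ i → trans (cong from (to-intertwines refl)) (from-to refl)
  where open Matching M

record ShortestCycle (π : Permutation′ n) (A : Fin n → Bool) : Set where
  constructor shortestCycle
  field
    a          : Fin n
    d          : ℕ
    a-period   : Period π a d
    a∈A        : A a ≡ true
    no-shorter : ∀ {j} → j < d → ¬ (0 < j × 0 < count (A ∩ Fix π j))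

shortest-cycle : ∀ {π : Permutation′ n} {m A} → 0 < m → π ^ₚ m ≈ Perm.id → 0 < count A → ShortestCycle π A
shortest-cycle {π = π} {m} {A} 0<m π^m≈id 0<|A|
  with d , (0<d , 0<|A∩Fixᵈ|) , no-shorter ← ∃-least (λ k → 0 <ℕ? k ×-dec 0 <ℕ? count (A ∩ Fix π k))
                                                     (0<m , subst (0 <_) (sym (count-∩-Fix-id A π m π^m≈id)) 0<|A|)
  with a , a∈A∩Fixᵈ ← 0<count⇒∈ {P = A ∩ Fix π d} 0<|A∩Fixᵈ|
  with a∈A , πᵈa≡a ← ∩-Fix-elim A π d a∈A∩Fixᵈ
  = shortestCycle a d a-period a∈A no-shorter
  where
  a-period : Period π a d
  a-period = record
    { positive = 0<d
    ; returns  = πᵈa≡a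
    ; minimal  = λ {j} 0<j j<d πʲa≡a → no-shorter j<d (0<j , ∈⇒0<count a (∩-Fix-intro A π j a∈A πʲa≡a))
    }

module _ {π₁ π₂ : Permutation′ n} {m : ℕ} (0<m : 0 < m)
         (π₁^m≈id : π₁ ^ₚ m ≈ Perm.id) (π₂^m≈id : π₂ ^ₚ m ≈ Perm.id) where

  FixCountsAgree : (A B : Fin n → Bool) → Set
  FixCountsAgree A B = ∀ {k} → k ∣ m → count (A ∩ Fix π₁ k) ≡ count (B ∩ Fix π₂ k)

  record MatchedCycles (A B : Fin n → Bool) : Set where
    field
      a b      : Fin n
      d        : ℕ
      a-period : Period π₁ a d
      b-period : Period π₂ b d
      a∈A      : A a ≡ true
      b∈B      : B b ≡ true

    O₁ O₂ A′ B′ : Fin n → Bool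
    O₁ = orbit π₁ a d
    O₂ = orbit π₂ b d
    A′ = A ∖ O₁
    B′ = B ∖ O₂

  period≡shortest-length : ∀ {A B b d q} → FixCountsAgree A B →
                           (∀ {j} → j < d → ¬ (0 < j × 0 < count (A ∩ Fix π₁ j))) →
                   0 < d → B b ≡ true → π₂ ^ d ⟨$⟩ b ≡ b → Period π₂ b q → q ≡ d
  period≡shortest-length {A} {B} {b} {d} {q} agree no-shorter 0<d b∈B πᵈb≡b q-period with <-cmp q d
  ... | tri< q<d _ _ = contradiction (Period.positive q-period , 0<|A∩Fixᑫ|) (no-shorter q<d)
    where
    0<|A∩Fixᑫ| : 0 < count (A ∩ Fix π₁ q)
    0<|A∩Fixᑫ| = subst (0 <_) (sym (agree (period-∣ q-period (π₂^m≈id b))))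
                       (∈⇒0<count b (∩-Fix-intro B π₂ q b∈B (Period.returns q-period)))
  ... | tri≈ _ q≡d _ = q≡d
  ... | tri> _ _ d<q = contradiction πᵈb≡b (Period.minimal q-period 0<d d<q)

  matched-cycles : ∀ {A B} → FixCountsAgree A B → 0 < count A → MatchedCycles A B
  matched-cycles {A} {B} agree 0<|A|
    with shortestCycle a d a-period a∈A no-shorter ← shortest-cycle 0<m π₁^m≈id 0<|A|
    with b , b∈B∩Fixᵈ ← 0<count⇒∈ {P = B ∩ Fix π₂ d}
                          (subst (0 <_) (agree (period-∣ a-period (π₁^m≈id a)))
                                 (∈⇒0<count a (∩-Fix-intro A π₁ d a∈A (Period.returns a-period))))
    with b∈B , πᵈb≡b ← ∩-Fix-elim B π₂ d b∈B∩Fixᵈ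
    with q , q-period ← period-exists (Period.positive a-period) πᵈb≡b
    = record
      { a = a ; b = b ; d = d ; a-period = a-period ; a∈A = a∈A ; b∈B = b∈B
      ; b-period = subst (Period π₂ b)
                         (period≡shortest-length agree no-shorter (Period.positive a-period) b∈B πᵈb≡b q-period)
                         q-period
      }

  remove-matched-cycles : ∀ {A B} → Invariant π₁ A → Invariant π₂ B → FixCountsAgree A B →
                          (c : MatchedCycles A B) → FixCountsAgree (MatchedCycles.A′ c) (MatchedCycles.B′ c)
  remove-matched-cycles {A} {B} A-inv B-inv agree c {k} k∣m = +-cancelʳ-≡ (count (O₁ ∩ Fix π₁ k)) _ _ (begin
    count (A′ ∩ Fix π₁ k) + count (O₁ ∩ Fix π₁ k) ≡⟨ count-∖-∩ {P = A} O₁⊆A (Fix π₁ k) ⟨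
    count (A ∩ Fix π₁ k)                          ≡⟨ agree k∣m ⟩
    count (B ∩ Fix π₂ k)                          ≡⟨ count-∖-∩ {P = B} O₂⊆B (Fix π₂ k) ⟩
    count (B′ ∩ Fix π₂ k) + count (O₂ ∩ Fix π₂ k) ≡⟨ cong (count (B′ ∩ Fix π₂ k) +_) (count-orbit-∩-Fix b-period a-period k) ⟩
    count (B′ ∩ Fix π₂ k) + count (O₁ ∩ Fix π₁ k) ∎)
    where
    open MatchedCycles c
    O₁⊆A : O₁ ⊆ A
    O₁⊆A = orbit-⊆ {π = π₁} {A} {a} {d} A-inv a∈A
    O₂⊆B : O₂ ⊆ B
    O₂⊆B = orbit-⊆ {π = π₂} {B} {b} {d} B-inv b∈B

  matching : ∀ {A B} → Acc _<_ (count A) → Invariant π₁ A → Invariant π₂ B → FixCountsAgree A B →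
             Matching π₁ π₂ A B
  matching {A} {B} (acc smaller) A-inv B-inv agree with count A ≟ℕ 0
  ... | yes |A|≡0 = empty-matching (count≡0⇒∉ {P = A} |A|≡0) (count≡0⇒∉ {P = B} |B|≡0)
    where
    |B|≡0 : count B ≡ 0
    |B|≡0 = begin
      count B              ≡⟨ count-∩-Fix-id B π₂ m π₂^m≈id ⟨
      count (B ∩ Fix π₂ m) ≡⟨ agree ∣-refl ⟨
      count (A ∩ Fix π₁ m) ≡⟨ count-∩-Fix-id A π₁ m π₁^m≈id ⟩
      count A              ≡⟨ |A|≡0 ⟩
      0                    ∎
  ... | no |A|≢0 =
    extend-matching a-period b-period A-inv B-inv a∈A b∈B
      (matching (smaller |A′|<|A|)
                (∖-invariant {π = π₁} {A} {O₁} A-inv (orbit-invariant a-period))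
                (∖-invariant {π = π₂} {B} {O₂} B-inv (orbit-invariant b-period))
                (remove-matched-cycles A-inv B-inv agree c))
    where
    c : MatchedCycles A B
    c = matched-cycles agree (n≢0⇒n>0 |A|≢0)
    open MatchedCycles c
    |A′|<|A| : count A′ < count A
    |A′|<|A| = subst (count A′ <_) (sym (count-∖-orbit A-inv a∈A a-period))
                     (m<m+n (count A′) (Period.positive a-period))

fix-pow≡⇒conjugate : ∀ {σ τ : Permutation′ n} {m} → 0 < m → σ ^ₚ m ≈ Perm.id → τ ^ₚ m ≈ Perm.id →
                     (∀ {k} → k ∣ m → fix (σ ^ₚ k) ≡ fix (τ ^ₚ k)) → Conjugate σ τ
fix-pow≡⇒conjugate {σ = σ} {τ} {m} 0<m σ^m≈id τ^m≈id fix≡ =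
  matching⇒conjugate (matching 0<m τ^m≈id σ^m≈id (<-wellFounded _) (λ _ → refl) (λ _ → refl) agree)
  where
  agree : ∀ {k} → k ∣ m → count (Fix τ k) ≡ count (Fix σ k)
  agree {k} k∣m = trans (sym (fix-pow≡count-Fix τ k)) (trans (sym (fix≡ k∣m)) (fix-pow≡count-Fix σ k))

module _ {π : Permutation′ n} {p : ℕ} where

  uniform-period⇒∣count : ∀ {S} → Acc _<_ (count S) → Invariant π S →
                          (∀ {z} → S z ≡ true → Period π z p) → p ∣ count S
  uniform-period⇒∣count {S} (acc smaller) S-inv period with count S ≟ℕ 0
  ... | yes |S|≡0 = subst (p ∣_) (sym |S|≡0) (p ∣0)
  ... | no  |S|≢0 with x , x∈S ← 0<count⇒∈ {P = S} (n≢0⇒n>0 |S|≢0) =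
    subst (p ∣_) (sym |S|≡|S′|+p)
          (∣m∣n⇒∣m+n (uniform-period⇒∣count (smaller |S′|<|S|) S′-inv S′-period) ∣-refl)
    where
    S′ = S ∖ orbit π x p
    |S|≡|S′|+p : count S ≡ count S′ + p
    |S|≡|S′|+p = count-∖-orbit S-inv x∈S (period x∈S)
    |S′|<|S| : count S′ < count S
    |S′|<|S| = subst (count S′ <_) (sym |S|≡|S′|+p) (m<m+n (count S′) (Period.positive (period x∈S)))
    S′-inv : Invariant π S′
    S′-inv = ∖-invariant {π = π} {S} {orbit π x p} S-inv (orbit-invariant (period x∈S))
    S′-period : ∀ {z} → S′ z ≡ true → Period π z p
    S′-period z∈S′ = period (proj₁ (∖-elim {P = S} {orbit π x p} z∈S′))

Fix-prime∖Fix-1⇒period : ∀ {π : Permutation′ n} {p z} → Prime p → (Fix π p ∖ Fix π 1) z ≡ true → Period π z p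
Fix-prime∖Fix-1⇒period {π = π} {p} {z} p-prime e
  with fixedᵖ , moved ← ∖-elim {P = Fix π p} {Fix π 1} e
  with q , q-period ← period-exists (>-nonZero⁻¹ p {{prime⇒nonZero p-prime}}) (Fix-elim π p fixedᵖ)
  with prime⇒irreducible p-prime (period-∣ q-period (Fix-elim π p fixedᵖ))
... | inj₁ refl = ∈-∉-elim (Fix-intro π 1 (Period.returns q-period)) moved
... | inj₂ refl = q-period

fix-pow≡count-Fix∖Fix-1+fix : ∀ (π : Permutation′ n) p → fix (π ^ₚ p) ≡ count (Fix π p ∖ Fix π 1) + fix π
fix-pow≡count-Fix∖Fix-1+fix π p = begin
  fix (π ^ₚ p)                                ≡⟨ fix-pow≡count-Fix π p ⟩
  count (Fix π p)                             ≡⟨ count-∖ {P = Fix π p} {Fix π 1} Fix-1⊆Fix-p ⟩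
  count (Fix π p ∖ Fix π 1) + count (Fix π 1) ≡⟨ cong (count (Fix π p ∖ Fix π 1) +_) (fix-pow≡count-Fix π 1) ⟨
  count (Fix π p ∖ Fix π 1) + fix π           ∎
  where
  Fix-1⊆Fix-p : Fix π 1 ⊆ Fix π p
  Fix-1⊆Fix-p e = Fix-intro π p (pow-fixed-∣ π (Fix-elim π 1 e) (1∣ p))

prime-∣-count-Fix∖Fix-1 : ∀ (π : Permutation′ n) {p} → Prime p → p ∣ count (Fix π p ∖ Fix π 1)
prime-∣-count-Fix∖Fix-1 π {p} p-prime =
  uniform-period⇒∣count (<-wellFounded _)
                        (∖-invariant {π = π} {Fix π p} {Fix π 1} (Fix-invariant π p) (Fix-invariant π 1))
                        (Fix-prime∖Fix-1⇒period p-prime)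

∣a∣b∧a+u≡b+v⇒∣∣u-v∣ : ∀ {p a b} u v → p ∣ a → p ∣ b → a + u ≡ b + v → p ∣ ∣ u - v ∣
∣a∣b∧a+u≡b+v⇒∣∣u-v∣ {p} u v (divides q refl) (divides r refl) e = divides ∣ r - q ∣ (begin
  ∣ u - v ∣                 ≡⟨ ∣m+n-m+o∣≡∣n-o∣ (q * p) u v ⟨
  ∣ q * p + u - q * p + v ∣ ≡⟨ cong₂ ∣_-_∣ e (+-comm (q * p) v) ⟩
  ∣ r * p + v - v + q * p ∣ ≡⟨ cong (λ t → ∣ t - v + q * p ∣) (+-comm (r * p) v) ⟩
  ∣ v + r * p - v + q * p ∣ ≡⟨ ∣m+n-m+o∣≡∣n-o∣ v (r * p) (q * p) ⟩
  ∣ r * p - q * p ∣         ≡⟨ *-distribʳ-∣-∣ p r q ⟨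
  ∣ r - q ∣ * p             ∎)

prime-∣-fix-difference : ∀ {σ τ : Permutation′ n} {p} → Prime p → fix (σ ^ₚ p) ≡ fix (τ ^ₚ p) →
                         p ∣ ∣ fix σ - fix τ ∣
prime-∣-fix-difference {σ = σ} {τ} {p} p-prime fixᵖ≡ =
  ∣a∣b∧a+u≡b+v⇒∣∣u-v∣ (fix σ) (fix τ) (prime-∣-count-Fix∖Fix-1 σ p-prime) (prime-∣-count-Fix∖Fix-1 τ p-prime)
    (trans (sym (fix-pow≡count-Fix∖Fix-1+fix σ p)) (trans fixᵖ≡ (fix-pow≡count-Fix∖Fix-1+fix τ p)))

lemma3p7 : (n m : ℕ) (σ τ : Permutation′ n) → AlmostSimilarOfOrder σ τ m →
    (fix σ ≡ fix τ → Conjugate σ τ) ×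
    (∀ p → Prime p → p ∣ m → p ∣ ∣ fix σ - fix τ ∣)
lemma3p7 n m σ τ ((0<m , σ^m≈id , _) , (_ , τ^m≈id , _) , conjugate-powers) =
  (λ fix≡ → fix-pow≡⇒conjugate {σ = σ} {τ} 0<m σ^m≈id τ^m≈id (fix-pow≡ fix≡)) ,
  (λ p p-prime p∣m →
    prime-∣-fix-difference {σ = σ} {τ} p-prime (fix-pow≡-≢1 p∣m λ { refl → ¬prime[1] p-prime }))
  where
  fix-pow≡-≢1 : ∀ {k} → k ∣ m → k ≢ 1 → fix (σ ^ₚ k) ≡ fix (τ ^ₚ k)
  fix-pow≡-≢1 {k} k∣m k≢1 = conjugate⇒fix≡ {σ = σ ^ₚ k} {τ ^ₚ k} (conjugate-powers k k∣m k≢1)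
  fix-pow≡ : fix σ ≡ fix τ → ∀ {k} → k ∣ m → fix (σ ^ₚ k) ≡ fix (τ ^ₚ k)
  fix-pow≡ fix≡ {k} k∣m with k ≟ℕ 1
  ... | yes refl = fix≡
  ... | no  k≢1  = fix-pow≡-≢1 k∣m k≢1
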